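{- Let $G$ be a complete wheel with cycle $C=\{c_1,\dots,c_{n-1}\}$ and central vertex $h$, and consider the condition on $L\subseteq V$: for every $i$, if $c_i\notin L$ then $c_{i-2},c_{i-1},c_{i+1},c_{i+2}\in L$. If $n\geq9$, then for $k\in\{3,4\}$ a set $L\subseteq C$ is an NL-landmark set for parameter $k$ if and only if it satisfies this condition, and $md_k^{NL}(G)=\lfloor 2n/3\rfloor$ for $k=3,4$. If $n=8$ and $k=3$, then $L\subseteq C$ is an NL-landmark set for parameter $3$ if and only if it satisfies this condition, and $md_3^{NL}(G)=5$.
   Context: The complete wheel on $n$ vertices has vertex set $V=C\cup\{h\}$ with $C=\{c_1,\dots,c_{n-1}\}$, edges $\{c_i,h\}$ and $\{c_i,c_{i+1}\}$ for $1\le i\le n-1$, indices modulo $n-1$. $d(x,y)$ denotes graph distance; $\tau$ separates distinct $u,v$ if $d(u,\tau)\neq d(v,\tau)$. $L\subseteq V$ is an NL-landmark set for parameter $k$ if every pair of distinct $u,v\in V\setminus L$ is separated by at least $k$ distinct vertices of $L$; $md_k^{NL}(G)$ is the minimum cardinality of such a set. -}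

module Defs where

open import Data.Nat using (ℕ; zero; suc; _+_; _≤_)
open import Data.Nat.DivMod using (_%_; m%n<n)
open import Data.Fin using (Fin; zero; suc; toℕ; fromℕ<)
open import Data.Fin.Subset using (Subset; _∈_; _∉_; _⊆_; ∣_∣)
open import Data.Product using (Σ; _×_; _,_)
open import Data.Sum using (_⊎_)
open import Data.Unit using (⊤)
open import Data.Empty using (⊥)
open import Relation.Nullary using (¬_)
open import Relation.Binary.PropositionalEquality using (_≡_; _≢_)

-- The complete wheel on n = 2 + r vertices (cycle length m = n - 1 = suc r).
-- Vertices: Fin (2 + r); 'zero' is the hub h, 'suc i' is the cycle vertex
-- c_{i+1} for i : Fin (suc r) (cycle indices 0 .. r, taken modulo suc r).

V : ℕ → Set
V r = Fin (suc (suc r))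

hub : ∀ {r} → V r
hub = zero

cyc : ∀ {r} → Fin (suc r) → V r
cyc i = suc i

next : ∀ {r} → Fin (suc r) → Fin (suc r)
next {r} i = fromℕ< (m%n<n (suc (toℕ i)) (suc r))

prev : ∀ {r} → Fin (suc r) → Fin (suc r)
prev {r} i = fromℕ< (m%n<n (toℕ i + r) (suc r))

Adj : ∀ {r} → V r → V r → Set
Adj zero    zero    = ⊥
Adj zero    (suc j) = ⊤
Adj (suc i) zero    = ⊤
Adj (suc i) (suc j) = (j ≡ next i) ⊎ (i ≡ next j)

data Walk {r : ℕ} : V r → V r → ℕ → Set where
  here : ∀ {x} → Walk x x 0
  step : ∀ {x y z ℓ} → Adj x y → Walk y z ℓ → Walk x z (suc ℓ)

IsDist : ∀ {r} → V r → V r → ℕ → Set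
IsDist x y d = Walk x y d × (∀ ℓ → Walk x y ℓ → d ≤ ℓ)

Separates : ∀ {r} → V r → V r → V r → Set
Separates τ u v = ¬ (Σ ℕ λ d → IsDist u τ d × IsDist v τ d)

IsNLLandmark : ∀ r → ℕ → Subset (suc (suc r)) → Set
IsNLLandmark r k L =
  ∀ (u v : V r) → u ≢ v → u ∉ L → v ∉ L →
  Σ (Subset (suc (suc r))) λ S →
    S ⊆ L × k ≤ ∣ S ∣ × (∀ τ → τ ∈ S → Separates τ u v)

IsMdNL : ∀ r → ℕ → ℕ → Set
IsMdNL r k d =
  (Σ (Subset (suc (suc r))) λ L → IsNLLandmark r k L × ∣ L ∣ ≡ d)
  × (∀ L → IsNLLandmark r k L → d ≤ ∣ L ∣)

Cond : ∀ r → Subset (suc (suc r)) → Set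
Cond r L = ∀ (i : Fin (suc r)) → cyc i ∉ L →
  (cyc (prev (prev i)) ∈ L) × (cyc (prev i) ∈ L)
  × (cyc (next i) ∈ L) × (cyc (next (next i)) ∈ L)

-- The
-- wheel has diameter 2 (consecutive cycle vertices at distance 1, other cycle vertices at
-- distance 2 through the hub, the hub at distance 1 from everything), so a vertex separates
-- a pair exactly when it is closer to one of them.  The central notion is a *spread* set:
-- every cycle vertex outside L is followed by two members, i.e. non-members on the cycle
-- are at least three steps apart.  This is the paper's condition read in one direction.
--  * Necessity: two non-members one or two steps apart are separated by only two
--    vertices, so a landmark set for k ≥ 3 is spread (landmark⇒spread).
--  * Sufficiency: in a spread set two non-members on the cycle are separated by four
--    explicit members (cycle-pair), and a non-member and the hub by the members at least
--    two steps away on both sides, of which there are four when n ≥ 9 and three when n = 8.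
--  * Size: every window of three consecutive cycle vertices of a spread set holds two
--    members; summing over all windows gives ∣L∣ ≥ ⌊2n/3⌋ (spread⇒size), and omitting
--    c_0, c_3, …, c_{3(q-1)} for q = ⌊(n-1)/3⌋ attains the bound (Extremal).

module Submission where

open import Defs
open import Data.Nat using (ℕ; zero; suc; _+_; _*_; _∸_; _≤_; _<_; z≤n; s≤s; s≤s⁻¹; _≟_; _<?_; _≤?_; NonZero)
open import Data.Nat.Properties
open import Data.Nat.Tactic.RingSolver using (solve-∀)
open import Algebra.Properties.CommutativeSemigroup +-commutativeSemigroup using (interchange)
open import Data.Nat.DivMod using (_/_; _%_; m≡m%n+[m/n]*n; +-distrib-/; m*n%n≡0; m*n/n≡m; m<n⇒m/n≡0; m<n*o⇒m/o<n; m%n<n; %-distribˡ-+; m%n%n≡m%n; m<n⇒m%n≡m; [m+n]%n≡m%n; m≤n⇒[n∸m]%m≡n%m)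
open import Data.Fin using (Fin; zero; suc; toℕ)
open import Data.Fin.Properties using (toℕ-fromℕ<; toℕ-injective; toℕ<n)
import Data.Fin.Properties as Fin
open import Data.Fin.Subset using (Subset; _∈_; _∉_; _⊆_; ∣_∣; ⁅_⁆; _∪_; _-_; inside; outside) renaming (⊥ to ∅)
open import Data.Fin.Subset.Properties using (_∈?_; ∣p∣≤∣x∷p∣; x∈⁅y⁆⇒x≡y; x∈⁅x⁆; x∈p∪q⁻; x∈p∪q⁺; p⊆q⇒∣p∣≤∣q∣; x∈p⇒∣p-x∣<∣p∣; x∈p∧x≢y⇒x∈p-y; ∉⊥; ∣⊥∣≡0; ∣⁅x⁆∣≡1)
open import Data.List using (List; []; _∷_; length; map)
open import Data.List.Membership.Propositional using () renaming (_∈_ to _∈ₗ_)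
open import Data.List.Properties using (length-map)
open import Data.List.Relation.Unary.All using (All; []; _∷_)
import Data.List.Relation.Unary.All as All
open import Data.List.Relation.Unary.All.Properties using (map⁺)
open import Data.List.Relation.Unary.Any using (here; there)
open import Data.List.Relation.Unary.AllPairs using (AllPairs; []; _∷_)
open import Data.List.Relation.Unary.Linked using (Linked; []; [-]; _∷_)
open import Data.List.Relation.Unary.Linked.Properties using (Linked⇒AllPairs)
open import Data.Bool using (Bool; true; false; not)
open import Data.Vec using ([]; _∷_; lookup; tabulate)
open import Data.Vec.Properties using ([]=⇒lookup; lookup⇒[]=; lookup∘tabulate)
open import Data.Product using (Σ; _×_; _,_; proj₁; proj₂)
open import Data.Sum using (_⊎_; inj₁; inj₂)
open import Data.Empty using (⊥; ⊥-elim)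
open import Function using (_∘_)
open import Function.Bundles using (_⇔_; mk⇔)
open import Relation.Nullary using (¬_; yes; no)
open import Relation.Nullary.Decidable using (decidable-stable)
open import Relation.Binary.PropositionalEquality
open import Relation.Binary.Definitions using (tri<; tri≈; tri>)

infixl 6 _⊕_
_⊕_ : ∀ {r} → Fin (suc r) → ℕ → Fin (suc r)
a ⊕ zero  = a
a ⊕ suc s = next (a ⊕ s)

toℕ-next : ∀ {r} (i : Fin (suc r)) → toℕ (next i) ≡ suc (toℕ i) % suc r
toℕ-next {r} i = toℕ-fromℕ< (m%n<n (suc (toℕ i)) (suc r))

suc-%-absorb : ∀ y m .{{_ : NonZero m}} → suc (y % m) % m ≡ suc y % m
suc-%-absorb y m = begin
  (1 + y % m) % m          ≡⟨ %-distribˡ-+ 1 (y % m) m ⟩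
  (1 % m + y % m % m) % m  ≡⟨ cong (λ z → (1 % m + z) % m) (m%n%n≡m%n y m) ⟩
  (1 % m + y % m) % m      ≡⟨ %-distribˡ-+ 1 y m ⟨
  (1 + y) % m              ∎
  where open ≡-Reasoning

toℕ-⊕ : ∀ {r} (a : Fin (suc r)) s → toℕ (a ⊕ s) ≡ (toℕ a + s) % suc r
toℕ-⊕ {r} a zero = begin
  toℕ a              ≡⟨ m<n⇒m%n≡m (toℕ<n a) ⟨
  toℕ a % suc r      ≡⟨ cong (_% suc r) (+-identityʳ (toℕ a)) ⟨
  (toℕ a + 0) % suc r ∎
  where open ≡-Reasoning
toℕ-⊕ {r} a (suc s) = begin
  toℕ (next (a ⊕ s))            ≡⟨ toℕ-next (a ⊕ s) ⟩
  suc (toℕ (a ⊕ s)) % suc r     ≡⟨ cong (λ z → suc z % suc r) (toℕ-⊕ a s) ⟩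
  suc ((toℕ a + s) % suc r) % suc r ≡⟨ suc-%-absorb (toℕ a + s) (suc r) ⟩
  suc (toℕ a + s) % suc r       ≡⟨ cong (_% suc r) (+-suc (toℕ a) s) ⟨
  (toℕ a + suc s) % suc r       ∎
  where open ≡-Reasoning

⊕-+ : ∀ {r} (a : Fin (suc r)) s t → a ⊕ (s + t) ≡ a ⊕ s ⊕ t
⊕-+ a s zero    = cong (a ⊕_) (+-identityʳ s)
⊕-+ a s (suc t) = trans (cong (a ⊕_) (+-suc s t)) (cong next (⊕-+ a s t))

⊕-period : ∀ {r} (a : Fin (suc r)) → a ⊕ suc r ≡ a
⊕-period {r} a = toℕ-injective (begin
  toℕ (a ⊕ suc r)          ≡⟨ toℕ-⊕ a (suc r) ⟩
  (toℕ a + suc r) % suc r  ≡⟨ [m+n]%n≡m%n (toℕ a) (suc r) ⟩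
  toℕ a % suc r            ≡⟨ m<n⇒m%n≡m (toℕ<n a) ⟩
  toℕ a                    ∎)
  where open ≡-Reasoning

prev≡⊕ : ∀ {r} (a : Fin (suc r)) → prev a ≡ a ⊕ r
prev≡⊕ {r} a = toℕ-injective (trans (toℕ-fromℕ< (m%n<n (toℕ a + r) (suc r))) (sym (toℕ-⊕ a r)))

next-prev : ∀ {r} (a : Fin (suc r)) → next (prev a) ≡ a
next-prev a = trans (cong next (prev≡⊕ a)) (⊕-period a)

%-once : ∀ {n m} .{{_ : NonZero m}} → m ≤ n → n ∸ m < m → n % m ≡ n ∸ m
%-once m≤n lt = trans (sym (m≤n⇒[n∸m]%m≡n%m m≤n)) (m<n⇒m%n≡m lt)

⊕-moves : ∀ {r} (a : Fin (suc r)) e → 0 < e → e ≤ r → a ⊕ e ≢ a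
⊕-moves {r} a e 0<e e≤r eq with toℕ a + e <? suc r
... | yes no-wrap = <⇒≢ (m<m+n (toℕ a) 0<e) (sym (begin
  toℕ a + e            ≡⟨ m<n⇒m%n≡m no-wrap ⟨
  (toℕ a + e) % suc r  ≡⟨ toℕ-⊕ a e ⟨
  toℕ (a ⊕ e)          ≡⟨ cong toℕ eq ⟩
  toℕ a                ∎))
  where open ≡-Reasoning
... | no wrap = <⇒≢ smaller (begin
  toℕ a + e ∸ suc r    ≡⟨ %-once m≤p+e (≤-trans smaller (<⇒≤ (toℕ<n a))) ⟨
  (toℕ a + e) % suc r  ≡⟨ toℕ-⊕ a e ⟨
  toℕ (a ⊕ e)          ≡⟨ cong toℕ eq ⟩
  toℕ a                ∎)
  where
  open ≡-Reasoning
  m≤p+e : suc r ≤ toℕ a + e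
  m≤p+e = ≮⇒≥ wrap
  smaller : toℕ a + e ∸ suc r < toℕ a
  smaller = ≤-trans (∸-monoʳ-< (s≤s e≤r) m≤p+e) (≤-reflexive (m+n∸n≡m (toℕ a) e))

⊕-distinct : ∀ {r} (a : Fin (suc r)) {s t} → s < t → t ≤ r → a ⊕ s ≢ a ⊕ t
⊕-distinct a {s} {t} s<t t≤r eq =
  ⊕-moves (a ⊕ s) (t ∸ s) (m<n⇒0<n∸m s<t) (≤-trans (m∸n≤m t s) t≤r) (begin
    a ⊕ s ⊕ (t ∸ s)  ≡⟨ ⊕-+ a s (t ∸ s) ⟨
    a ⊕ (s + (t ∸ s)) ≡⟨ cong (a ⊕_) (m+[n∸m]≡n (<⇒≤ s<t)) ⟩
    a ⊕ t            ≡⟨ eq ⟨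
    a ⊕ s            ∎)
  where open ≡-Reasoning

⊕-injective : ∀ {r} (a : Fin (suc r)) {s t} → s ≤ r → t ≤ r → a ⊕ s ≡ a ⊕ t → s ≡ t
⊕-injective a {s} {t} s≤r t≤r eq with <-cmp s t
... | tri< s<t _ _ = ⊥-elim (⊕-distinct a s<t t≤r eq)
... | tri≈ _ s≡t _ = s≡t
... | tri> _ _ t<s = ⊥-elim (⊕-distinct a t<s s≤r (sym eq))

⊕-surjective : ∀ {r} (a b : Fin (suc r)) → Σ ℕ λ s → s ≤ r × a ⊕ s ≡ b
⊕-surjective {r} a b with toℕ a ≤? toℕ b
... | yes a≤b = toℕ b ∸ toℕ a , ≤-trans (m∸n≤m (toℕ b) (toℕ a)) (s≤s⁻¹ (toℕ<n b)) ,
  toℕ-injective (begin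
    toℕ (a ⊕ (toℕ b ∸ toℕ a))          ≡⟨ toℕ-⊕ a _ ⟩
    (toℕ a + (toℕ b ∸ toℕ a)) % suc r  ≡⟨ cong (_% suc r) (m+[n∸m]≡n a≤b) ⟩
    toℕ b % suc r                      ≡⟨ m<n⇒m%n≡m (toℕ<n b) ⟩
    toℕ b                              ∎)
  where open ≡-Reasoning
... | no b<a = suc r + toℕ b ∸ toℕ a , within-turn ,
  toℕ-injective (begin
    toℕ (a ⊕ (suc r + toℕ b ∸ toℕ a))          ≡⟨ toℕ-⊕ a _ ⟩
    (toℕ a + (suc r + toℕ b ∸ toℕ a)) % suc r  ≡⟨ cong (_% suc r) (m+[n∸m]≡n a≤m+b) ⟩
    (suc r + toℕ b) % suc r                    ≡⟨ cong (_% suc r) (+-comm (suc r) (toℕ b)) ⟩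
    (toℕ b + suc r) % suc r                    ≡⟨ [m+n]%n≡m%n (toℕ b) (suc r) ⟩
    toℕ b % suc r                              ≡⟨ m<n⇒m%n≡m (toℕ<n b) ⟩
    toℕ b                                      ∎)
  where
  open ≡-Reasoning
  a≤m+b : toℕ a ≤ suc r + toℕ b
  a≤m+b = ≤-trans (<⇒≤ (toℕ<n a)) (m≤m+n (suc r) (toℕ b))
  within-turn : suc r + toℕ b ∸ toℕ a ≤ r
  within-turn = ≤-trans (∸-monoʳ-≤ (suc r + toℕ b) (≰⇒> b<a)) (≤-reflexive (begin
    suc r + toℕ b ∸ suc (toℕ b)    ≡⟨ cong (_∸ suc (toℕ b)) (+-suc r (toℕ b)) ⟨
    r + suc (toℕ b) ∸ suc (toℕ b)  ≡⟨ m+n∸n≡m r (suc (toℕ b)) ⟩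
    r                              ∎))

Adj-sym : ∀ {r} {x y : V r} → Adj x y → Adj y x
Adj-sym {x = zero}  {suc j} _ = _
Adj-sym {x = suc i} {zero}  _ = _
Adj-sym {x = suc i} {suc j} (inj₁ j≡next-i) = inj₂ j≡next-i
Adj-sym {x = suc i} {suc j} (inj₂ i≡next-j) = inj₁ i≡next-j

walk-snoc : ∀ {r} {x y z : V r} {ℓ} → Walk x y ℓ → Adj y z → Walk x z (suc ℓ)
walk-snoc here       yz = step yz here
walk-snoc (step xy w) yz = step xy (walk-snoc w yz)

walk-reverse : ∀ {r} {x y : V r} {ℓ} → Walk x y ℓ → Walk y x ℓ
walk-reverse here        = here
walk-reverse (step xy w) = walk-snoc (walk-reverse w) (Adj-sym xy)

IsDist-sym : ∀ {r} {x y : V r} {d} → IsDist x y d → IsDist y x d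
IsDist-sym (w , shortest) = walk-reverse w , λ ℓ w′ → shortest ℓ (walk-reverse w′)

IsDist-unique : ∀ {r} {x y : V r} {d d′} → IsDist x y d → IsDist x y d′ → d ≡ d′
IsDist-unique (w , shortest) (w′ , shortest′) = ≤-antisym (shortest _ w′) (shortest′ _ w)

separates : ∀ {r} {u v τ : V r} {d d′} → IsDist u τ d → IsDist v τ d′ → d ≢ d′ → Separates τ u v
separates du dv d≢d′ (e , du′ , dv′) = d≢d′ (trans (IsDist-unique du du′) (IsDist-unique dv′ dv))

not-separates : ∀ {r} {u v τ : V r} {d} → IsDist u τ d → IsDist v τ d → ¬ Separates τ u v
not-separates du dv sep = sep (_ , du , dv)

Separates-sym : ∀ {r} {u v τ : V r} → Separates τ u v → Separates τ v u
Separates-sym sep (d , dv , du) = sep (d , du , dv)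

walk-0 : ∀ {r} {x y : V r} → Walk x y 0 → x ≡ y
walk-0 here = refl

walk-1 : ∀ {r} {x y : V r} → Walk x y 1 → Adj x y
walk-1 (step xy here) = xy

dist-cyc-hub : ∀ {r} (a : Fin (suc r)) → IsDist (cyc a) hub 1
dist-cyc-hub a = step _ here , shortest
  where
  shortest : ∀ ℓ → Walk (cyc a) hub ℓ → 1 ≤ ℓ
  shortest zero w with walk-0 w
  ... | ()
  shortest (suc ℓ) w = s≤s z≤n

dist-adjacent : ∀ {r} {a b : Fin (suc r)} → a ≢ b → Adj (cyc a) (cyc b) → IsDist (cyc a) (cyc b) 1
dist-adjacent a≢b ab = step ab here , shortest
  where
  shortest : ∀ ℓ → Walk _ _ ℓ → 1 ≤ ℓ
  shortest zero w with walk-0 w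
  ... | refl = ⊥-elim (a≢b refl)
  shortest (suc ℓ) w = s≤s z≤n

dist-apart : ∀ {r} {a b : Fin (suc r)} → a ≢ b → ¬ Adj (cyc a) (cyc b) → IsDist (cyc a) (cyc b) 2
dist-apart a≢b ¬ab = step {y = hub} _ (step _ here) , shortest
  where
  shortest : ∀ ℓ → Walk _ _ ℓ → 2 ≤ ℓ
  shortest zero          w with walk-0 w
  ... | refl = ⊥-elim (a≢b refl)
  shortest (suc zero)    w = ⊥-elim (¬ab (walk-1 w))
  shortest (suc (suc ℓ)) w = s≤s (s≤s z≤n)

at : ∀ {r} → Fin (suc r) → ℕ → V r
at a s = cyc (a ⊕ s)

dist-next : ∀ {r} (a : Fin (suc r)) s → 1 ≤ r → IsDist (at a s) (at a (suc s)) 1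
dist-next a s 1≤r = dist-adjacent (λ eq → ⊕-moves (a ⊕ s) 1 (s≤s z≤n) 1≤r (sym eq)) (inj₁ refl)

dist-prev : ∀ {r} (a : Fin (suc r)) → 1 ≤ r → IsDist (at a 0) (at a r) 1
dist-prev {r} a 1≤r = subst (λ x → IsDist (cyc x) (at a r) 1) (⊕-period a) (IsDist-sym (dist-next a r 1≤r))

dist-far : ∀ {r} (a : Fin (suc r)) s e → 2 ≤ e → e < r → IsDist (at a s) (at a (s + e)) 2
dist-far {r} a s e 2≤e e<r = subst (λ x → IsDist (at a s) (cyc x) 2) (sym (⊕-+ a s e))
  (dist-apart (λ eq → ⊕-moves b e (≤-trans (s≤s z≤n) 2≤e) (<⇒≤ e<r) (sym eq)) not-adjacent)
  where
  b : Fin (suc r)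
  b = a ⊕ s
  not-adjacent : ¬ Adj (cyc b) (cyc (b ⊕ e))
  not-adjacent (inj₁ e-is-1) with ⊕-injective b (<⇒≤ e<r) (≤-trans (≤-trans (s≤s z≤n) 2≤e) (<⇒≤ e<r)) e-is-1
  ... | refl = <-irrefl refl 2≤e
  not-adjacent (inj₂ wraps) with ⊕-injective b z≤n e<r wraps
  ... | ()

offset : ∀ {r} (a : Fin (suc r)) (τ : V r) → τ ≡ hub ⊎ Σ ℕ λ s → s ≤ r × τ ≡ at a s
offset a zero    = inj₁ refl
offset a (suc b) with ⊕-surjective a b
... | s , s≤r , a⊕s≡b = inj₂ (s , s≤r , cong suc (sym a⊕s≡b))

Resolved : ∀ {r} → ℕ → Subset (2 + r) → V r → V r → Set
Resolved {r} k L u v = Σ (Subset (2 + r)) λ S → S ⊆ L × k ≤ ∣ S ∣ × (∀ τ → τ ∈ S → Separates τ u v)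

Resolved-mono : ∀ {r j k} {L : Subset (2 + r)} {u v : V r} → j ≤ k → Resolved k L u v → Resolved j L u v
Resolved-mono j≤k (S , S⊆L , k≤∣S∣ , sep) = S , S⊆L , ≤-trans j≤k k≤∣S∣ , sep

Resolved-sym : ∀ {r k} {L : Subset (2 + r)} {u v : V r} → Resolved k L u v → Resolved k L v u
Resolved-sym (S , S⊆L , k≤∣S∣ , sep) = S , S⊆L , k≤∣S∣ , λ τ τ∈S → Separates-sym (sep τ τ∈S)

fromList : ∀ {n} → List (Fin n) → Subset n
fromList []       = ∅
fromList (x ∷ xs) = ⁅ x ⁆ ∪ fromList xs

∈-fromList⁻ : ∀ {n} {τ : Fin n} xs → τ ∈ fromList xs → τ ∈ₗ xs
∈-fromList⁻ []       τ∈ = ⊥-elim (∉⊥ τ∈)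
∈-fromList⁻ (x ∷ xs) τ∈ with x∈p∪q⁻ ⁅ x ⁆ (fromList xs) τ∈
... | inj₁ τ∈⁅x⁆ = here (x∈⁅y⁆⇒x≡y x τ∈⁅x⁆)
... | inj₂ τ∈xs  = there (∈-fromList⁻ xs τ∈xs)

∈-fromList⁺ : ∀ {n} {τ : Fin n} xs → τ ∈ₗ xs → τ ∈ fromList xs
∈-fromList⁺ (x ∷ xs) (here refl) = x∈p∪q⁺ (inj₁ (x∈⁅x⁆ x))
∈-fromList⁺ (x ∷ xs) (there τ∈) = x∈p∪q⁺ (inj₂ (∈-fromList⁺ xs τ∈))

∣∪∣≤ : ∀ {n} (p q : Subset n) → ∣ p ∪ q ∣ ≤ ∣ p ∣ + ∣ q ∣
∣∪∣≤ []            []            = z≤n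
∣∪∣≤ (outside ∷ p) (outside ∷ q) = ∣∪∣≤ p q
∣∪∣≤ (outside ∷ p) (inside ∷ q)  = ≤-trans (s≤s (∣∪∣≤ p q)) (≤-reflexive (sym (+-suc ∣ p ∣ ∣ q ∣)))
∣∪∣≤ (inside ∷ p)  (outside ∷ q) = s≤s (∣∪∣≤ p q)
∣∪∣≤ (inside ∷ p)  (inside ∷ q)  = s≤s (≤-trans (∣∪∣≤ p q) (+-monoʳ-≤ ∣ p ∣ (n≤1+n ∣ q ∣)))

∣fromList∣≤length : ∀ {n} (xs : List (Fin n)) → ∣ fromList xs ∣ ≤ length xs
∣fromList∣≤length {n} []   = ≤-reflexive (∣⊥∣≡0 n)
∣fromList∣≤length (x ∷ xs) = begin
  ∣ ⁅ x ⁆ ∪ fromList xs ∣       ≤⟨ ∣∪∣≤ ⁅ x ⁆ (fromList xs) ⟩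
  ∣ ⁅ x ⁆ ∣ + ∣ fromList xs ∣   ≡⟨ cong (_+ ∣ fromList xs ∣) (∣⁅x⁆∣≡1 x) ⟩
  suc ∣ fromList xs ∣           ≤⟨ s≤s (∣fromList∣≤length xs) ⟩
  suc (length xs)               ∎
  where open ≤-Reasoning

length≤∣∣ : ∀ {n} (S : Subset n) {xs : List (Fin n)} → AllPairs _≢_ xs → All (_∈ S) xs → length xs ≤ ∣ S ∣
length≤∣∣ S {[]}     _                _            = z≤n
length≤∣∣ S {x ∷ xs} (x≢xs ∷ distinct) (x∈S ∷ xs⊆S) =
  ≤-trans (s≤s (length≤∣∣ (S - x) distinct (remove-x x≢xs xs⊆S))) (x∈p⇒∣p-x∣<∣p∣ x∈S)
  where
  remove-x : ∀ {ys} → All (x ≢_) ys → All (_∈ S) ys → All (_∈ S - x) ys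
  remove-x []              []              = []
  remove-x (x≢y ∷ x≢ys) (y∈S ∷ ys⊆S) = x∈p∧x≢y⇒x∈p-y y∈S (x≢y ∘ sym) ∷ remove-x x≢ys ys⊆S

resolved≤2 : ∀ {r k} {L : Subset (2 + r)} {u v : V r} (x y : V r) →
  (∀ τ → τ ∈ L → Separates τ u v → τ ≡ x ⊎ τ ≡ y) → Resolved k L u v → k ≤ 2
resolved≤2 {k = k} x y only-xy (S , S⊆L , k≤∣S∣ , sep) = begin
  k                            ≤⟨ k≤∣S∣ ⟩
  ∣ S ∣                        ≤⟨ p⊆q⇒∣p∣≤∣q∣ S⊆xy ⟩
  ∣ fromList (x ∷ y ∷ []) ∣    ≤⟨ ∣fromList∣≤length (x ∷ y ∷ []) ⟩
  2                            ∎
  where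
  open ≤-Reasoning
  S⊆xy : S ⊆ fromList (x ∷ y ∷ [])
  S⊆xy {τ} τ∈S with only-xy τ (S⊆L τ∈S) (sep τ τ∈S)
  ... | inj₁ refl = ∈-fromList⁺ (x ∷ y ∷ []) (here refl)
  ... | inj₂ refl = ∈-fromList⁺ (x ∷ y ∷ []) (there (here refl))

resolved-by-list : ∀ {r} {L : Subset (2 + r)} {u v : V r} (xs : List (V r)) → AllPairs _≢_ xs →
  All (λ τ → τ ∈ L × Separates τ u v) xs → Resolved (length xs) L u v
resolved-by-list xs distinct good =
  fromList xs ,
  (λ τ∈ → proj₁ (All.lookup good (∈-fromList⁻ xs τ∈))) ,
  length≤∣∣ (fromList xs) distinct (All.tabulate (∈-fromList⁺ xs)) ,
  (λ τ τ∈ → proj₂ (All.lookup good (∈-fromList⁻ xs τ∈)))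

at-distinct : ∀ {r} (a : Fin (suc r)) {s t} → s < t → t ≤ r → at a s ≢ at a t
at-distinct a s<t t≤r = ⊕-distinct a s<t t≤r ∘ Fin.suc-injective

distinct-offsets : ∀ {r} (a : Fin (suc r)) {ts : List ℕ} →
  Linked _<_ ts → All (_≤ r) ts → AllPairs _≢_ (map (at a) ts)
distinct-offsets {r} a increasing = go (Linked⇒AllPairs <-trans increasing)
  where
  differs : ∀ {t ts} → All (t <_) ts → All (_≤ r) ts → All (at a t ≢_) (map (at a) ts)
  differs []            []              = []
  differs (t<s ∷ t<ts) (s≤r ∷ ts≤r) = at-distinct a t<s s≤r ∷ differs t<ts ts≤r
  go : ∀ {ts} → AllPairs _<_ ts → All (_≤ r) ts → AllPairs _≢_ (map (at a) ts)
  go []                  []            = []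
  go (t<ts ∷ increasing) (_ ∷ ts≤r) = differs t<ts ts≤r ∷ go increasing ts≤r

resolved-by-offsets : ∀ {r} {L : Subset (2 + r)} {u v : V r} (a : Fin (suc r)) (ts : List ℕ) →
  Linked _<_ ts → All (λ t → t ≤ r × at a t ∈ L × Separates (at a t) u v) ts → Resolved (length ts) L u v
resolved-by-offsets {L = L} {u} {v} a ts increasing good =
  subst (λ k → Resolved k L u v) (length-map (at a) ts)
    (resolved-by-list (map (at a) ts) (distinct-offsets a increasing (All.map proj₁ good))
                      (map⁺ (All.map proj₂ good)))

Spread : ∀ {r} → Subset (2 + r) → Set
Spread {r} L = ∀ (a : Fin (suc r)) → cyc a ∉ L → at a 1 ∈ L × at a 2 ∈ L

∈-stable : ∀ {n} {x : Fin n} {L : Subset n} → ¬ x ∉ L → x ∈ L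
∈-stable {x = x} {L} = decidable-stable (x ∈? L)

cond⇒spread : ∀ {r} {L : Subset (2 + r)} → Cond r L → Spread L
cond⇒spread cond a a∉L with cond a a∉L
... | _ , _ , next∈L , next²∈L = next∈L , next²∈L

spread⇒cond : ∀ {r} {L : Subset (2 + r)} → Spread L → Cond r L
spread⇒cond {L = L} spread i i∉L = prev²∈L , prev∈L , proj₁ (spread i i∉L) , proj₂ (spread i i∉L)
  where
  prev∈L : cyc (prev i) ∈ L
  prev∈L = ∈-stable λ prev∉L →
    i∉L (subst (λ x → cyc x ∈ L) (next-prev i) (proj₁ (spread (prev i) prev∉L)))
  prev²∈L : cyc (prev (prev i)) ∈ L
  prev²∈L = ∈-stable λ prev²∉L →
    i∉L (subst (λ x → cyc x ∈ L) (trans (cong next (next-prev (prev i))) (next-prev i))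
                (proj₂ (spread (prev (prev i)) prev²∉L)))

-- Necessity.  For s ∈ {1, 2} only c_{a+s+1} and c_{a-1} separate c_a from c_{a+s}:
-- the hub and every other cycle vertex are equidistant from both.

far-from-both : ∀ {r} (a : Fin (suc r)) s t → suc s < t → t < r → ¬ Separates (at a t) (at a 0) (at a s)
far-from-both a s t s+1<t t<r = not-separates
  (dist-far a 0 t (≤-trans (s≤s (s≤s z≤n)) s+1<t) t<r)
  (subst (λ x → IsDist (at a s) (at a x) 2) (m+[n∸m]≡n (≤-trans (n≤1+n s) (<⇒≤ s+1<t)))
    (dist-far a s (t ∸ s) (m+n≤o⇒m≤o∸n 2 s+1<t) (≤-<-trans (m∸n≤m t s) t<r)))

-- the hub is adjacent to every cycle vertex
hub-not-separating : ∀ {r} (a b : Fin (suc r)) → ¬ Separates hub (cyc a) (cyc b)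
hub-not-separating a b = not-separates (dist-cyc-hub a) (dist-cyc-hub b)

separators-adjacent : ∀ {r} → 4 ≤ r → ∀ (a : Fin (suc r)) τ → τ ≢ at a 0 → τ ≢ at a 1 →
  Separates τ (at a 0) (at a 1) → τ ≡ at a 2 ⊎ τ ≡ at a r
separators-adjacent {r} 4≤r a τ τ≢u τ≢v sep with offset a τ
... | inj₁ refl = ⊥-elim (hub-not-separating _ _ sep)
... | inj₂ (0 , _ , refl) = ⊥-elim (τ≢u refl)
... | inj₂ (1 , _ , refl) = ⊥-elim (τ≢v refl)
... | inj₂ (2 , _ , refl) = inj₁ refl
... | inj₂ (t@(suc (suc (suc _))) , t≤r , refl) with t ≟ r
...   | yes t≡r = inj₂ (cong (at a) t≡r)
...   | no t≢r  = ⊥-elim (far-from-both a 1 t (s≤s (s≤s (s≤s z≤n))) (≤∧≢⇒< t≤r t≢r) sep)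

separators-gap : ∀ {r} → 4 ≤ r → ∀ (a : Fin (suc r)) τ → τ ≢ at a 0 → τ ≢ at a 2 →
  Separates τ (at a 0) (at a 2) → τ ≡ at a 3 ⊎ τ ≡ at a r
separators-gap {r} 4≤r a τ τ≢u τ≢v sep with offset a τ
... | inj₁ refl = ⊥-elim (hub-not-separating _ _ sep)
... | inj₂ (0 , _ , refl) = ⊥-elim (τ≢u refl)
... | inj₂ (1 , _ , refl) = ⊥-elim (not-separates (dist-next a 0 1≤r) (IsDist-sym (dist-next a 1 1≤r)) sep)
  where
  1≤r : 1 ≤ r
  1≤r = ≤-trans (s≤s z≤n) 4≤r
... | inj₂ (2 , _ , refl) = ⊥-elim (τ≢v refl)
... | inj₂ (3 , _ , refl) = inj₁ refl
... | inj₂ (t@(suc (suc (suc (suc _)))) , t≤r , refl) with t ≟ r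
...   | yes t≡r = inj₂ (cong (at a) t≡r)
...   | no t≢r  = ⊥-elim (far-from-both a 2 t (s≤s (s≤s (s≤s (s≤s z≤n)))) (≤∧≢⇒< t≤r t≢r) sep)

landmark⇒spread : ∀ {r k} {L : Subset (2 + r)} → 3 ≤ k → 4 ≤ r → IsNLLandmark r k L → Spread L
landmark⇒spread {r} {k} {L} 3≤k 4≤r landmark a u∉L =
  ∈-stable (λ v∉L → unresolvable (at a 2) (at a r) v∉L (at-distinct a (s≤s z≤n) 1≤r)
                                 (separators-adjacent 4≤r a)) ,
  ∈-stable (λ v∉L → unresolvable (at a 3) (at a r) v∉L (at-distinct a (s≤s z≤n) 2≤r)
                                 (separators-gap 4≤r a))
  where
  1≤r : 1 ≤ r
  1≤r = ≤-trans (s≤s z≤n) 4≤r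
  2≤r : 2 ≤ r
  2≤r = ≤-trans (s≤s (s≤s z≤n)) 4≤r
  unresolvable : ∀ {v} x y → v ∉ L → cyc a ≢ v →
    (∀ τ → τ ≢ cyc a → τ ≢ v → Separates τ (cyc a) v → τ ≡ x ⊎ τ ≡ y) → ⊥
  unresolvable x y v∉L u≢v only-xy =
    <-irrefl refl (≤-trans 3≤k (resolved≤2 x y separators (landmark _ _ u≢v u∉L v∉L)))
    where
    separators : ∀ τ → τ ∈ L → Separates τ (cyc a) _ → τ ≡ x ⊎ τ ≡ y
    separators τ τ∈L = only-xy τ (λ { refl → u∉L τ∈L }) (λ { refl → v∉L τ∈L })

resolve-by-cases : ∀ {r k} {L : Subset (2 + r)} →
  (∀ a → cyc a ∉ L → Resolved k L (cyc a) hub) →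
  (∀ a b → a ≢ b → cyc a ∉ L → cyc b ∉ L → Resolved k L (cyc a) (cyc b)) →
  IsNLLandmark r k L
resolve-by-cases hub-pair cycle-pair zero    zero    u≢v _   _   = ⊥-elim (u≢v refl)
resolve-by-cases hub-pair cycle-pair zero    (suc b) _   _   b∉L = Resolved-sym (hub-pair b b∉L)
resolve-by-cases hub-pair cycle-pair (suc a) zero    _   a∉L _   = hub-pair a a∉L
resolve-by-cases hub-pair cycle-pair (suc a) (suc b) u≢v a∉L b∉L = cycle-pair a b (u≢v ∘ cong suc) a∉L b∉L

-- every cycle vertex 2 ≤ t < r steps after c_a separates c_a (distance 2) from the hub (distance 1)
hub-separator : ∀ {r} (a : Fin (suc r)) t → 2 ≤ t → t < r → Separates (at a t) (at a 0) hub
hub-separator a t 2≤t t<r = separates (dist-far a 0 t 2≤t t<r) (IsDist-sym (dist-cyc-hub _)) λ ()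

-- Consequences of spreading on a cycle of length suc r, r = suc r₁; the offsets r₁ and
-- r from c_a are c_{a-2} and c_{a-1}.
module Spreading {r₁ : ℕ} {L : Subset (3 + r₁)} (spread : Spread L) where

  r : ℕ
  r = suc r₁

  after : ∀ a s → at a s ∉ L → at a (suc s) ∈ L
  after a s = proj₁ ∘ spread (a ⊕ s)

  before : ∀ a s → at a (suc s) ∉ L → at a s ∈ L
  before a s next∉L = ∈-stable λ ∉L → next∉L (after a s ∉L)

  before² : ∀ a s → at a (2 + s) ∉ L → at a s ∈ L
  before² a s next²∉L = ∈-stable λ ∉L → next²∉L (proj₂ (spread (a ⊕ s) ∉L))

  behind₁ : ∀ a → cyc a ∉ L → at a r ∈ L
  behind₁ a a∉L = before a r (subst (λ x → cyc x ∉ L) (sym (⊕-period a)) a∉L)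

  behind₂ : ∀ a → cyc a ∉ L → at a r₁ ∈ L
  behind₂ a a∉L = before² a r₁ (subst (λ x → cyc x ∉ L) (sym (⊕-period a)) a∉L)

  one-of-two : ∀ a s → Σ ℕ λ x → s ≤ x × x ≤ suc s × at a x ∈ L
  one-of-two a s with at a s ∈? L
  ... | yes ∈L = s , ≤-refl , n≤1+n s , ∈L
  ... | no ∉L  = suc s , n≤1+n s , ≤-refl , after a s ∉L

  two-of-three : ∀ a s → Σ ℕ λ x → Σ ℕ λ y → s ≤ x × x < y × y ≤ 2 + s × at a x ∈ L × at a y ∈ L
  two-of-three a s with at a s ∈? L
  ... | no ∉L = suc s , 2 + s , n≤1+n s , ≤-refl , ≤-refl , spread (a ⊕ s) ∉L
  ... | yes ∈L with one-of-two a (suc s)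
  ...   | x , s<x , x≤ , x∈L = s , x , ≤-refl , s<x , x≤ , ∈L , x∈L

  hub-witness : ∀ a t → 2 ≤ t → t < r → at a t ∈ L → t ≤ r × at a t ∈ L × Separates (at a t) (cyc a) hub
  hub-witness a t 2≤t t<r t∈L = <⇒≤ t<r , t∈L , hub-separator a t 2≤t t<r

  -- with cycle length ≥ 7: offsets 2, 3 or 4, and r₁
  hub-pair₃ : 5 ≤ r₁ → ∀ a → cyc a ∉ L → Resolved 3 L (cyc a) hub
  hub-pair₃ 5≤r₁ a a∉L with one-of-two a 3
  ... | x , 3≤x , x≤4 , x∈L = resolved-by-offsets a (2 ∷ x ∷ r₁ ∷ [])
    (3≤x ∷ x<r₁ ∷ [-])
    (hub-witness a 2 ≤-refl (<-trans 2<r₁ (n<1+n r₁)) (proj₂ (spread a a∉L)) ∷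
     hub-witness a x (≤-trans (n≤1+n 2) 3≤x) (<-trans x<r₁ (n<1+n r₁)) x∈L ∷
     hub-witness a r₁ (<⇒≤ 2<r₁) (n<1+n r₁) (behind₂ a a∉L) ∷ [])
    where
    x<r₁ : x < r₁
    x<r₁ = ≤-trans (s≤s x≤4) 5≤r₁
    2<r₁ : 2 < r₁
    2<r₁ = <-trans 3≤x x<r₁

  -- with cycle length ≥ 8: offsets 2, two of 3, 4, 5, and r₁
  hub-pair₄ : 6 ≤ r₁ → ∀ a → cyc a ∉ L → Resolved 4 L (cyc a) hub
  hub-pair₄ 6≤r₁ a a∉L with two-of-three a 3
  ... | x , y , 3≤x , x<y , y≤5 , x∈L , y∈L = resolved-by-offsets a (2 ∷ x ∷ y ∷ r₁ ∷ [])
    (3≤x ∷ x<y ∷ y<r₁ ∷ [-])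
    (hub-witness a 2 ≤-refl (<-trans 2<r₁ (n<1+n r₁)) (proj₂ (spread a a∉L)) ∷
     hub-witness a x (≤-trans (n≤1+n 2) 3≤x) (<-trans (<-trans x<y y<r₁) (n<1+n r₁)) x∈L ∷
     hub-witness a y (≤-trans (n≤1+n 2) (<⇒≤ (≤-<-trans 3≤x x<y))) (<-trans y<r₁ (n<1+n r₁)) y∈L ∷
     hub-witness a r₁ (<⇒≤ 2<r₁) (n<1+n r₁) (behind₂ a a∉L) ∷ [])
    where
    y<r₁ : y < r₁
    y<r₁ = ≤-trans (s≤s y≤5) 6≤r₁
    2<r₁ : 2 < r₁
    2<r₁ = <-trans 3≤x (<-trans x<y y<r₁)

  -- two non-members 3 + e steps apart (with at least two more steps back to c_a) are
  -- separated by c_{a+1}, c_{a+2+e}, c_{a+4+e} and c_{a-1}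
  cycle-pair-apart : ∀ a e → 4 + e ≤ r₁ → cyc a ∉ L → at a (3 + e) ∉ L → Resolved 4 L (cyc a) (at a (3 + e))
  cycle-pair-apart a e 4+e≤r₁ u∉L v∉L = resolved-by-offsets a (1 ∷ 2 + e ∷ 4 + e ∷ r ∷ [])
    (s≤s (s≤s z≤n) ∷ n≤1+n (3 + e) ∷ 4+e<r ∷ [-])
    ((s≤s z≤n , after a 0 u∉L ,
        separates (dist-next a 0 1≤r) (IsDist-sym (dist-far a 1 (2 + e) (s≤s (s≤s z≤n)) 2+e<r)) λ ()) ∷
     (<⇒≤ 2+e<r , before a (2 + e) v∉L ,
        separates (dist-far a 0 (2 + e) (s≤s (s≤s z≤n)) 2+e<r) (IsDist-sym (dist-next a (2 + e) 1≤r)) λ ()) ∷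
     (<⇒≤ 4+e<r , after a (3 + e) v∉L ,
        separates (dist-far a 0 (4 + e) (s≤s (s≤s z≤n)) 4+e<r) (dist-next a (3 + e) 1≤r) λ ()) ∷
     (≤-refl , behind₁ a u∉L ,
        separates (dist-prev a 1≤r)
          (subst (λ t → IsDist (at a (3 + e)) (at a t) 2) (m+[n∸m]≡n 2+e<r)
            (dist-far a (3 + e) (r ∸ (3 + e)) (m+n≤o⇒m≤o∸n 2 (s≤s 4+e≤r₁)) (s≤s (m∸n≤m r₁ (2 + e)))))
          λ ()) ∷ [])
    where
    1≤r : 1 ≤ r
    1≤r = s≤s z≤n
    4+e<r : 4 + e < r
    4+e<r = s≤s 4+e≤r₁
    2+e<r : 2 + e < r
    2+e<r = ≤-trans (n≤1+n (3 + e)) (<⇒≤ 4+e<r)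

  cycle-pair : 4 ≤ r₁ → ∀ a b → a ≢ b → cyc a ∉ L → cyc b ∉ L → Resolved 4 L (cyc a) (cyc b)
  cycle-pair 4≤r₁ a b a≢b a∉L b∉L with ⊕-surjective a b
  ... | D , D≤r , refl = by-offset D D≤r a≢b b∉L
    where
    by-offset : ∀ D → D ≤ r → a ≢ a ⊕ D → at a D ∉ L → Resolved 4 L (cyc a) (at a D)
    by-offset 0 _ a≢a _ = ⊥-elim (a≢a refl)
    by-offset 1 _ _ v∉L = ⊥-elim (v∉L (proj₁ (spread a a∉L)))
    by-offset 2 _ _ v∉L = ⊥-elim (v∉L (proj₂ (spread a a∉L)))
    by-offset (suc (suc (suc e))) D≤r _ v∉L with 3 + e ≟ r₁ | 3 + e ≟ r
    ... | yes D≡r₁ | _        = ⊥-elim (v∉L (subst (λ t → at a t ∈ L) (sym D≡r₁) (behind₂ a a∉L)))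
    ... | no _     | yes D≡r  = ⊥-elim (v∉L (subst (λ t → at a t ∈ L) (sym D≡r) (behind₁ a a∉L)))
    ... | no D≢r₁  | no D≢r   = cycle-pair-apart a e (≤∧≢⇒< (s≤s⁻¹ (≤∧≢⇒< D≤r D≢r)) D≢r₁) a∉L v∉L

-- Lower bound.  Summing "at least two of any three consecutive cycle vertices are members"
-- over all m windows counts every member three times, so 2m ≤ 3∣L∣.

sumBelow : ℕ → (ℕ → ℕ) → ℕ
sumBelow zero    h = 0
sumBelow (suc n) h = h 0 + sumBelow n (λ i → h (suc i))

sumBelow-last : ∀ n h → sumBelow (suc n) h ≡ sumBelow n h + h n
sumBelow-last zero    h = +-comm (h 0) 0
sumBelow-last (suc n) h = trans (cong (h 0 +_) (sumBelow-last n (λ i → h (suc i)))) (sym (+-assoc (h 0) _ _))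

sumBelow-rotate : ∀ n h → h n ≡ h 0 → sumBelow n (λ i → h (suc i)) ≡ sumBelow n h
sumBelow-rotate n h periodic = +-cancelˡ-≡ (h 0) _ _ (begin
  h 0 + sumBelow n (λ i → h (suc i))  ≡⟨ sumBelow-last n h ⟩
  sumBelow n h + h n                  ≡⟨ cong (sumBelow n h +_) periodic ⟩
  sumBelow n h + h 0                  ≡⟨ +-comm (sumBelow n h) (h 0) ⟩
  h 0 + sumBelow n h                  ∎)
  where open ≡-Reasoning

sumBelow-+ : ∀ n f g → sumBelow n (λ i → f i + g i) ≡ sumBelow n f + sumBelow n g
sumBelow-+ zero    f g = refl
sumBelow-+ (suc n) f g =
  trans (cong (f 0 + g 0 +_) (sumBelow-+ n (λ i → f (suc i)) (λ i → g (suc i)))) (interchange (f 0) (g 0) _ _)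

sumBelow-≥ : ∀ n c h → (∀ i → c ≤ h i) → n * c ≤ sumBelow n h
sumBelow-≥ zero    c h _     = z≤n
sumBelow-≥ (suc n) c h c≤h = +-mono-≤ (c≤h 0) (sumBelow-≥ n c (λ i → h (suc i)) (λ i → c≤h (suc i)))

window-bound : ∀ n h → h n ≡ h 0 → h (suc n) ≡ h 1 →
  (∀ i → 2 ≤ h i + h (1 + i) + h (2 + i)) → n * 2 ≤ 3 * sumBelow n h
window-bound n h periodic₀ periodic₁ window = begin
  n * 2                                                    ≤⟨ sumBelow-≥ n 2 _ window ⟩
  sumBelow n (λ i → h i + h (1 + i) + h (2 + i))           ≡⟨ sumBelow-+ n _ (λ i → h (2 + i)) ⟩
  sumBelow n (λ i → h i + h (1 + i)) + sumBelow n (λ i → h (2 + i))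
      ≡⟨ cong (_+ sumBelow n (λ i → h (2 + i))) (sumBelow-+ n h (λ i → h (suc i))) ⟩
  sumBelow n h + sumBelow n (λ i → h (suc i)) + sumBelow n (λ i → h (2 + i))
      ≡⟨ cong₂ (λ x y → sumBelow n h + x + y) shift₁ (trans shift₂ shift₁) ⟩
  sumBelow n h + sumBelow n h + sumBelow n h               ≡⟨ thrice (sumBelow n h) ⟩
  3 * sumBelow n h                                         ∎
  where
  open ≤-Reasoning
  shift₁ : sumBelow n (λ i → h (suc i)) ≡ sumBelow n h
  shift₁ = sumBelow-rotate n h periodic₀
  shift₂ : sumBelow n (λ i → h (2 + i)) ≡ sumBelow n (λ i → h (suc i))
  shift₂ = sumBelow-rotate n (λ i → h (suc i)) periodic₁
  thrice : ∀ x → x + x + x ≡ 3 * x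
  thrice = solve-∀

χ : Bool → ℕ
χ true  = 1
χ false = 0

count-by-index : ∀ {n} (p : Subset n) (h : ℕ → ℕ) → (∀ j → h (toℕ j) ≡ χ (lookup p j)) → sumBelow n h ≡ ∣ p ∣
count-by-index []            h agree = refl
count-by-index (inside ∷ p)  h agree = cong₂ _+_ (agree zero) (count-by-index p (λ i → h (suc i)) (agree ∘ suc))
count-by-index (outside ∷ p) h agree = cong₂ _+_ (agree zero) (count-by-index p (λ i → h (suc i)) (agree ∘ suc))

weight : ∀ {n} → Subset n → Fin n → ℕ
weight L τ = χ (lookup L τ)

weight-∈ : ∀ {n} {L : Subset n} {τ} → τ ∈ L → 1 ≤ weight L τ
weight-∈ τ∈L rewrite []=⇒lookup τ∈L = ≤-refl

spread-window : ∀ {r} {L : Subset (2 + r)} → Spread L → ∀ a →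
  2 ≤ weight L (at a 0) + weight L (at a 1) + weight L (at a 2)
spread-window {L = L} spread a with cyc a ∈? L
... | no a∉L =
  +-mono-≤ (+-mono-≤ (z≤n {weight L (cyc a)}) (weight-∈ (proj₁ (spread a a∉L)))) (weight-∈ (proj₂ (spread a a∉L)))
... | yes a∈L with at a 1 ∈? L
...   | yes next∈L = +-mono-≤ (+-mono-≤ (weight-∈ a∈L) (weight-∈ next∈L)) z≤n
...   | no next∉L  = +-mono-≤ (+-mono-≤ (weight-∈ a∈L) z≤n) (weight-∈ (proj₁ (spread (a ⊕ 1) next∉L)))

floor-bound : ∀ m c → m * 2 ≤ 3 * c → (2 * (1 + m)) / 3 ≤ c
floor-bound m c 2m≤3c = s≤s⁻¹ (m<n*o⇒m/o<n (begin-strict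
  2 * (1 + m)   ≡⟨ expand m ⟩
  2 + m * 2     ≤⟨ +-monoʳ-≤ 2 2m≤3c ⟩
  2 + 3 * c     <⟨ n<1+n (2 + 3 * c) ⟩
  3 + 3 * c     ≡⟨ collect c ⟩
  suc c * 3     ∎))
  where
  open ≤-Reasoning
  expand : ∀ m → 2 * (1 + m) ≡ 2 + m * 2
  expand = solve-∀
  collect : ∀ c → 3 + 3 * c ≡ suc c * 3
  collect = solve-∀

spread⇒size : ∀ {r} (L : Subset (2 + r)) → Spread L → (2 * (2 + r)) / 3 ≤ ∣ L ∣
spread⇒size {r} L@(l ∷ p) spread = ≤-trans (floor-bound (suc r) ∣ p ∣ 2m≤3∣p∣) (∣p∣≤∣x∷p∣ l p)
  where
  h : ℕ → ℕ
  h i = weight L (at zero i)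
  counted : sumBelow (suc r) h ≡ ∣ p ∣
  counted = count-by-index p h λ j →
    cong (weight p) (toℕ-injective (trans (toℕ-⊕ zero (toℕ j)) (m<n⇒m%n≡m (toℕ<n j))))
  2m≤3∣p∣ : suc r * 2 ≤ 3 * ∣ p ∣
  2m≤3∣p∣ = subst (λ c → suc r * 2 ≤ 3 * c) counted
    (window-bound (suc r) h (cong (weight p) (⊕-period zero)) (cong (weight p ∘ next) (⊕-period zero))
      (spread-window spread ∘ (zero ⊕_)))

-- The extremal set.  With m = q·3 + s, leave out the hub and the q cycle vertices
-- c_0, c_3, …, c_{3(q-1)}; the remaining 2q + s vertices form a spread set.

dropped : ℕ → ℕ → Bool
dropped zero    j                   = false
dropped (suc q) zero                = true
dropped (suc q) (suc zero)          = false
dropped (suc q) (suc (suc zero))    = false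
dropped (suc q) (suc (suc (suc j))) = dropped q j

dropped-bound : ∀ q j → dropped q j ≡ true → 3 + j ≤ q * 3
dropped-bound (suc q) zero                _       = m≤m+n 3 (q * 3)
dropped-bound (suc q) (suc (suc (suc j))) dropped = +-monoʳ-≤ 3 (dropped-bound q j dropped)

dropped-next₁ : ∀ q j → dropped q j ≡ true → dropped q (1 + j) ≡ false
dropped-next₁ (suc q) zero                _       = refl
dropped-next₁ (suc q) (suc (suc (suc j))) dropped = dropped-next₁ q j dropped

dropped-next₂ : ∀ q j → dropped q j ≡ true → dropped q (2 + j) ≡ false
dropped-next₂ (suc q) zero                _       = refl
dropped-next₂ (suc q) (suc (suc (suc j))) dropped = dropped-next₂ q j dropped

kept-count : ∀ q s → sumBelow (q * 3 + s) (λ j → χ (not (dropped q j))) ≡ q * 2 + s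
kept-count zero    s = ones s
  where
  ones : ∀ s → sumBelow s (λ _ → 1) ≡ s
  ones zero    = refl
  ones (suc s) = cong suc (ones s)
kept-count (suc q) s = cong (2 +_) (kept-count q s)

exact-division : ∀ A t → t < 3 → (A * 3 + t) / 3 ≡ A
exact-division A t t<3 = begin
  (A * 3 + t) / 3    ≡⟨ +-distrib-/ (A * 3) t (subst (_< 3) (sym (cong₂ _+_ (m*n%n≡0 A 3) (m<n⇒m%n≡m t<3))) t<3) ⟩
  A * 3 / 3 + t / 3  ≡⟨ cong₂ _+_ (m*n/n≡m A 3) (m<n⇒m/n≡0 t<3) ⟩
  A + 0              ≡⟨ +-identityʳ A ⟩
  A                  ∎
  where open ≡-Reasoning

floor-value : ∀ q s → s < 3 → (2 * (1 + (q * 3 + s))) / 3 ≡ q * 2 + s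
floor-value q 0 _ = trans (cong (_/ 3) (expand q)) (exact-division (q * 2 + 0) 2 (s≤s (s≤s (s≤s z≤n))))
  where
  expand : ∀ q → 2 * (1 + (q * 3 + 0)) ≡ (q * 2 + 0) * 3 + 2
  expand = solve-∀
floor-value q 1 _ = trans (cong (_/ 3) (expand q)) (exact-division (q * 2 + 1) 1 (s≤s (s≤s z≤n)))
  where
  expand : ∀ q → 2 * (1 + (q * 3 + 1)) ≡ (q * 2 + 1) * 3 + 1
  expand = solve-∀
floor-value q 2 _ = trans (cong (_/ 3) (expand q)) (exact-division (q * 2 + 2) 0 (s≤s z≤n))
  where
  expand : ∀ q → 2 * (1 + (q * 3 + 2)) ≡ (q * 2 + 2) * 3 + 0
  expand = solve-∀
floor-value q (suc (suc (suc _))) (s≤s (s≤s (s≤s ())))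

module Extremal (r : ℕ) where

  q : ℕ
  q = suc r / 3

  s : ℕ
  s = suc r % 3

  m≡q*3+s : suc r ≡ q * 3 + s
  m≡q*3+s = trans (m≡m%n+[m/n]*n (suc r) 3) (+-comm s (q * 3))

  q*3≤m : q * 3 ≤ suc r
  q*3≤m = subst (q * 3 ≤_) (sym m≡q*3+s) (m≤m+n (q * 3) s)

  kept : Fin (suc r) → Bool
  kept j = not (dropped q (toℕ j))

  L₀ : Subset (2 + r)
  L₀ = outside ∷ tabulate kept

  L₀-size : ∣ L₀ ∣ ≡ (2 * (2 + r)) / 3
  L₀-size = begin
    ∣ tabulate kept ∣                            ≡⟨ count-by-index (tabulate kept) h (λ j → cong χ (sym (lookup∘tabulate kept j))) ⟨
    sumBelow (suc r) h                           ≡⟨ cong (λ n → sumBelow n h) m≡q*3+s ⟩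
    sumBelow (q * 3 + s) h                       ≡⟨ kept-count q s ⟩
    q * 2 + s                                    ≡⟨ floor-value q s (m%n<n (suc r) 3) ⟨
    (2 * (1 + (q * 3 + s))) / 3                  ≡⟨ cong (λ n → (2 * (1 + n)) / 3) m≡q*3+s ⟨
    (2 * (2 + r)) / 3                            ∎
    where
    open ≡-Reasoning
    h : ℕ → ℕ
    h j = χ (not (dropped q j))

  kept-∈ : ∀ t → dropped q (toℕ t) ≡ false → cyc t ∈ L₀
  kept-∈ t not-dropped = lookup⇒[]= (suc t) L₀ (trans (lookup∘tabulate kept t) (cong not not-dropped))

  toℕ-next-inside : ∀ (t : Fin (suc r)) → suc (toℕ t) < suc r → toℕ (next t) ≡ suc (toℕ t)
  toℕ-next-inside t no-wrap = trans (toℕ-next t) (m<n⇒m%n≡m no-wrap)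

  -- a dropped position is at least three before the end, so its two successors are kept
  L₀-spread : Spread L₀
  L₀-spread a a∉L₀ with dropped q (toℕ a) in a-dropped
  ... | false = ⊥-elim (a∉L₀ (kept-∈ a a-dropped))
  ... | true  =
    kept-∈ (next a) (trans (cong (dropped q) next₁) (dropped-next₁ q (toℕ a) a-dropped)) ,
    kept-∈ (next (next a)) (trans (cong (dropped q) next₂) (dropped-next₂ q (toℕ a) a-dropped))
    where
    3+a≤m : 3 + toℕ a ≤ suc r
    3+a≤m = ≤-trans (dropped-bound q (toℕ a) a-dropped) q*3≤m
    next₁ : toℕ (next a) ≡ 1 + toℕ a
    next₁ = toℕ-next-inside a (≤-trans (n≤1+n (2 + toℕ a)) 3+a≤m)
    next₂ : toℕ (next (next a)) ≡ 2 + toℕ a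
    next₂ = trans (toℕ-next-inside (next a) (subst (λ x → suc x < suc r) (sym next₁) 3+a≤m))
                  (cong suc next₁)

-- Assembly.  Cycle–cycle pairs of a spread set are always resolved four times; the hub
-- pairs need a long enough cycle, which is where the two cases of the theorem differ.
HubResolving : ℕ → ℕ → Set
HubResolving r₁ k = ∀ {L : Subset (3 + r₁)} → Spread L → ∀ a → cyc a ∉ L → Resolved k L (cyc a) hub

spread⇒landmark : ∀ {r₁ k} {L : Subset (3 + r₁)} → k ≤ 4 → 4 ≤ r₁ → HubResolving r₁ k → Spread L →
  IsNLLandmark (suc r₁) k L
spread⇒landmark k≤4 4≤r₁ hub-pairs spread = resolve-by-cases (hub-pairs spread)
  λ a b a≢b a∉L b∉L → Resolved-mono k≤4 (Spreading.cycle-pair spread 4≤r₁ a b a≢b a∉L b∉L)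

wheel-theorem : ∀ {r₁ k} → 3 ≤ k → k ≤ 4 → 4 ≤ r₁ → HubResolving r₁ k →
  (∀ (L : Subset (3 + r₁)) → hub ∉ L → (IsNLLandmark (suc r₁) k L ⇔ Cond (suc r₁) L))
  × IsMdNL (suc r₁) k ((2 * (3 + r₁)) / 3)
wheel-theorem {r₁} {k} 3≤k k≤4 4≤r₁ hub-pairs =
  (λ L _ → mk⇔ (spread⇒cond ∘ necessary) (spread⇒landmark k≤4 4≤r₁ hub-pairs ∘ cond⇒spread)) ,
  (L₀ , spread⇒landmark k≤4 4≤r₁ hub-pairs L₀-spread , L₀-size) ,
  (λ L landmark → spread⇒size L (necessary landmark))
  where
  open Extremal (suc r₁)
  necessary : ∀ {L} → IsNLLandmark (suc r₁) k L → Spread L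
  necessary = landmark⇒spread 3≤k (≤-trans 4≤r₁ (n≤1+n r₁))

between-3-4 : ∀ {k} → k ≡ 3 ⊎ k ≡ 4 → 3 ≤ k × k ≤ 4
between-3-4 (inj₁ refl) = ≤-refl , n≤1+n 3
between-3-4 (inj₂ refl) = n≤1+n 3 , ≤-refl

wheel-n≥9 : ∀ r → 9 ≤ 2 + r → ∀ (k : ℕ) → (k ≡ 3 ⊎ k ≡ 4) →
  (∀ (L : Subset (2 + r)) → hub ∉ L → (IsNLLandmark r k L ⇔ Cond r L)) × IsMdNL r k ((2 * (2 + r)) / 3)
wheel-n≥9 zero (s≤s (s≤s ()))
wheel-n≥9 (suc r₁) 9≤n k k≡3∨4 with between-3-4 k≡3∨4
... | 3≤k , k≤4 = wheel-theorem 3≤k k≤4 (≤-trans (n≤1+n 4) (≤-trans (n≤1+n 5) 6≤r₁))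
  λ spread a a∉L → Resolved-mono k≤4 (Spreading.hub-pair₄ spread 6≤r₁ a a∉L)
  where
  6≤r₁ : 6 ≤ r₁
  6≤r₁ = s≤s⁻¹ (s≤s⁻¹ (s≤s⁻¹ 9≤n))

wheel-n=8 : ∀ r → 2 + r ≡ 8 →
  (∀ (L : Subset (2 + r)) → hub ∉ L → (IsNLLandmark r 3 L ⇔ Cond r L)) × IsMdNL r 3 5
wheel-n=8 .6 refl = wheel-theorem ≤-refl (n≤1+n 3) (n≤1+n 4) λ spread → Spreading.hub-pair₃ spread ≤-refl

mainTheorem12 : ∀ (r : ℕ) →
    (9 ≤ 2 + r → ∀ (k : ℕ) → (k ≡ 3 ⊎ k ≡ 4) →
      (∀ (L : Subset (2 + r)) → hub ∉ L → (IsNLLandmark r k L ⇔ Cond r L))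
      × IsMdNL r k ((2 * (2 + r)) / 3))
    × (2 + r ≡ 8 →
      (∀ (L : Subset (2 + r)) → hub ∉ L → (IsNLLandmark r 3 L ⇔ Cond r L))
      × IsMdNL r 3 5)
mainTheorem12 r = wheel-n≥9 r , wheel-n=8 r
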